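{- For positive integers $r,c$, let $(c^r)$ denote the rectangular partition with $r$ rows each of length $c$. Then the number of leaves in the game tree of LCTR played on $(c^r)$ equals $\binom{r+c}{r}$.
   Context: A partition $\lambda=(\lambda_1,\dots,\lambda_r)$ with $\lambda_1\ge\dots\ge\lambda_r>0$ is identified with its Young diagram. For integers $i,j\ge 0$, $\lambda[i,j]$ denotes the subpartition obtained by deleting the top $i$ rows and the leftmost $j$ columns (the empty partition $()$ if nothing remains). In the impartial game LCTR played on $\lambda$, a move replaces $\lambda$ by $\lambda[1,0]$ (remove the top row) or by $\lambda[0,1]$ (remove the left column); the empty partition $()$ is the terminal position. The game tree of a position $p$ is the rooted tree with root $p$ and, for each move $p\to\tilde p$, an edge from $p$ to the root of the game tree of $\tilde p$ (so repeated positions appear as distinct nodes); its leaves are the occurrences of terminal positions. -}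

module Defs where

open import Data.Nat using (ℕ; zero; suc; _+_; _∸_; _≥_)
open import Data.List using (List; []; _∷_; map; filter; replicate)
open import Data.Nat.ListAction using (sum)
open import Data.Nat.Properties using (_≟_)
open import Relation.Nullary using (¬_)
open import Relation.Nullary.Decidable using (¬?)

-- A partition is a list of row lengths λ₁ ≥ … ≥ λᵣ > 0 (top row first).
Partition : Set
Partition = List ℕ

removeRow : Partition → Partition
removeRow []       = []
removeRow (_ ∷ xs) = xs

removeCol : Partition → Partition
removeCol xs = filter (λ n → ¬? (n ≟ 0)) (map (λ n → n ∸ 1) xs)

size : Partition → ℕ
size = sum

-- Game tree of LCTR: root p, one child subtree per move p → p̃ (two moves
-- from every nonempty position, none from the terminal position ()).
data GameTree : Set where
  node : Partition → List GameTree → GameTree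

-- fuel-bounded construction; each move removes ≥ 1 cell, so fuel = size p suffices
gameTreeF : ℕ → Partition → GameTree
gameTreeF _       []       = node [] []
gameTreeF zero    p        = node p []
gameTreeF (suc k) (x ∷ xs) =
  node (x ∷ xs) (gameTreeF k (removeRow (x ∷ xs)) ∷ gameTreeF k (removeCol (x ∷ xs)) ∷ [])

gameTree : Partition → GameTree
gameTree p = gameTreeF (size p) p

mutual
  leaves : GameTree → ℕ
  leaves (node _ [])       = 1
  leaves (node _ (t ∷ ts)) = leavesL (t ∷ ts)

  leavesL : List GameTree → ℕ
  leavesL []       = 0
  leavesL (t ∷ ts) = leaves t + leavesL ts

rect : ℕ → ℕ → Partition
rect r c = replicate r c

-- Deleting the top row or the left column of an r × c rectangle leaves an
-- (r−1) × c or an r × (c−1) rectangle, and a rectangle with a zero side is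
-- the terminal position. So the leaf count L(r, c) obeys Pascal's rule
-- L(r, c) = L(r−1, c) + L(r, c−1) with L = 1 on the boundary, whence
-- L(r, c) = (r + c) C r.
module Submission where

open import Defs
open import Data.Nat using (ℕ; zero; suc; _+_; _*_; _≤_; s≤s)
open import Data.Nat.Combinatorics using (_C_; nCn≡1; nCk+nC[k+1]≡[n+1]C[k+1])
open import Data.Nat.Properties using (+-identityʳ; +-suc; +-comm; +-monoʳ-≤; m≤m*n)
open import Data.List using ([]; _∷_)
open import Function using (_∘_)
open import Relation.Binary.PropositionalEquality
  using (_≡_; refl; sym; trans; cong; cong₂; subst; module ≡-Reasoning)

-- Unlike rect r 0, which is a list of r empty rows, box r 0 is the empty
-- partition.
box : ℕ → ℕ → Partition
box r zero    = []
box r (suc c) = rect r (suc c)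

removeCol-box : ∀ r c → removeCol (box r (suc c)) ≡ box r c
removeCol-box zero    zero    = refl
removeCol-box zero    (suc c) = refl
removeCol-box (suc r) zero    = removeCol-box r zero
removeCol-box (suc r) (suc c) = cong (suc c ∷_) (removeCol-box r (suc c))

leaves-gameTreeF-[] : ∀ k → leaves (gameTreeF k []) ≡ 1
leaves-gameTreeF-[] zero    = refl
leaves-gameTreeF-[] (suc k) = refl

-- Fuel k suffices for box r c as soon as r + c ≤ suc k: every move lowers
-- r + c by one and the play stops once a side reaches zero.
leaves-gameTreeF-box : ∀ k r c → r + c ≤ suc k →
  leaves (gameTreeF k (box r c)) ≡ (r + c) C r
leaves-gameTreeF-box k zero zero _ = leaves-gameTreeF-[] k
leaves-gameTreeF-box k zero (suc c) _ = leaves-gameTreeF-[] k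
leaves-gameTreeF-box k (suc r) zero _ = begin
  leaves (gameTreeF k [])  ≡⟨ leaves-gameTreeF-[] k ⟩
  1                        ≡⟨ sym (nCn≡1 (suc r)) ⟩
  suc r C suc r            ≡⟨ cong (_C suc r) (sym (+-identityʳ (suc r))) ⟩
  (suc r + 0) C suc r      ∎
  where open ≡-Reasoning
leaves-gameTreeF-box zero (suc r) (suc c) (s≤s r+1+c≤0)
  with () ← subst (_≤ 0) (+-suc r c) r+1+c≤0
leaves-gameTreeF-box (suc k) (suc r) (suc c) (s≤s r+1+c≤k) = begin
  leaves (gameTreeF k (box r (suc c)))
    + (leaves (gameTreeF k (removeCol (box (suc r) (suc c)))) + 0)
    ≡⟨ cong₂ _+_ (leaves-gameTreeF-box k r (suc c) r+1+c≤k)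
                 (trans (+-identityʳ _) (cong (leaves ∘ gameTreeF k) (removeCol-box (suc r) c))) ⟩
  (r + suc c) C r + leaves (gameTreeF k (box (suc r) c))
    ≡⟨ cong ((r + suc c) C r +_)
            (leaves-gameTreeF-box k (suc r) c (subst (_≤ suc k) (+-suc r c) r+1+c≤k)) ⟩
  (r + suc c) C r + (suc r + c) C suc r
    ≡⟨ cong (λ n → (r + suc c) C r + n C suc r) (sym (+-suc r c)) ⟩
  (r + suc c) C r + (r + suc c) C suc r
    ≡⟨ nCk+nC[k+1]≡[n+1]C[k+1] (r + suc c) r ⟩
  (suc r + suc c) C suc r
    ∎
  where open ≡-Reasoning

size-rect : ∀ r c → size (rect r c) ≡ r * c
size-rect zero    c = refl
size-rect (suc r) c = cong (c +_) (size-rect r c)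

rect-sides≤size : ∀ r c → r + suc c ≤ size (rect (suc r) (suc c))
rect-sides≤size r c = subst (r + suc c ≤_) (sym (size-rect (suc r) (suc c)))
  (subst (_≤ suc c + r * suc c) (+-comm (suc c) r) (+-monoʳ-≤ (suc c) (m≤m*n r (suc c))))

lemma6p8 : (r c : ℕ) → leaves (gameTree (rect (suc r) (suc c))) ≡ (suc r + suc c) C (suc r)
lemma6p8 r c =
  leaves-gameTreeF-box (size (rect (suc r) (suc c))) (suc r) (suc c) (s≤s (rect-sides≤size r c))
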